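{- Let $a\in\mathbb{Z}$, $m,n,t\in\mathbb{N}$, $k\in\mathbb{N}$ with $k\ge 2$, and $r_{m,i}=1+\left\lfloor\frac{m-1}{p_i}\right\rfloor$ for $i=k,\dots,n$. Then for any $t<k$, $$\sum_{i=k}^n \nu(a,m,i)\le \sum_{i=k}^n r_{m,i}-\sum_{i=k}^n \psi_{min}(r_{m,i},t).$$
   Context: Let $p_1=2,p_2=3,p_3=5,\dots$ be the primes in increasing order. For $a\in\mathbb{Z}$, $m\in\mathbb{N}$, define $\psi(a,m,1)=0$ and, for $k\ge 2$, $\psi(a,m,k)=|\{q\in\{1,\dots,m\}\mid \exists i\in\{2,\dots,k\}: a+q\equiv 0\pmod{p_i}\}|$ (the prime $2$ is not used). Define $\nu(a,m,1)=0$ and $\nu(a,m,k)=\psi(a,m,k)-\psi(a,m,k-1)$ for $k\ge2$. Further $\psi_{min}(m,k)=\min_{a\in\mathbb{Z}}\psi(a,m,k)$. $\lfloor x\rfloor$ is the greatest integer not exceeding $x$. -}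

module Defs where

open import Data.Nat as ℕ using (ℕ; zero; suc; _∸_; _!; NonZero; _≤_)
open import Data.Nat.Properties using (≤-refl; ≤-trans; n≤1+n; ≤-pred)
open import Data.Nat.Divisibility using (_∣?_)
open import Data.Nat.DivMod using (_/_)
open import Data.Nat.Primality using (prime?)
open import Data.Integer as ℤ using (ℤ; +_; ∣_∣)
open import Data.List using (List; upTo; map; filterᵇ; length; foldr)
open import Data.Bool.ListAction using (any)
open import Data.Bool using (Bool; if_then_else_)
open import Relation.Nullary.Decidable using (does; ⌊_⌋)
open import Relation.Nullary using (Dec)
open import Data.Product using (Σ; _×_)
open import Relation.Binary.PropositionalEquality using (_≡_)

-- The primes p₁ = 2, p₂ = 3, p₃ = 5, … (1-indexed; p 0 is a dummy value
-- that is never used).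

findPrime : ℕ → ℕ → ℕ
findPrime zero      s = s
findPrime (suc f) s = if does (prime? s) then s else findPrime f (suc s)

-- least prime > n : by Euclid there is a prime in (n, n! + 1], which lies
-- in the searched range n+1, …, n + n! (for n ≥ 1).
nextPrime : ℕ → ℕ
nextPrime n = findPrime (n !) (suc n)

p : ℕ → ℕ
p zero          = 2
p (suc zero)    = 2
p (suc (suc i)) = nextPrime (p (suc i))

findPrime-≥ : ∀ f s → s ≤ findPrime f s
findPrime-≥ zero s = ≤-refl
findPrime-≥ (suc f) s with does (prime? s)
... | Bool.true  = ≤-refl
... | Bool.false = ≤-trans (n≤1+n s) (findPrime-≥ f (suc s))

p-nonZero : ∀ i → NonZero (p i)
p-nonZero zero = _
p-nonZero (suc zero) = _
p-nonZero (suc (suc i)) = ℕ.>-nonZero (ℕ.s≤s ℕ.z≤n ⟨≤⟩ findPrime-≥ (p (suc i) !) (suc (p (suc i))))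
  where open Data.Nat.Properties using () renaming (≤-trans to _⟨≤⟩_)


-- ψ(a,m,k) = |{ q ∈ {1,…,m} | ∃ i ∈ {2,…,k}. p_i ∣ a + q }|
-- (divisibility in ℤ, i.e. Data.Integer.Divisibility._∣_, which is
-- ℕ-divisibility of absolute values). For k = 1 the index range is empty,
-- so ψ(a,m,1) = 0 as in the paper.

range : ℕ → ℕ → List ℕ
range lo hi = map (lo ℕ.+_) (upTo (suc hi ∸ lo))

hit : ℤ → ℕ → ℕ → Bool
hit a k q = any (λ i → ⌊ p i ∣? ∣ a ℤ.+ + q ∣ ⌋) (range 2 k)

ψ : ℤ → ℕ → ℕ → ℕ
ψ a m k = length (filterᵇ (hit a k) (range 1 m))

ν : ℤ → ℕ → ℕ → ℤ
ν a m zero          = + 0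
ν a m (suc zero)    = + 0
ν a m (suc (suc k)) = + ψ a m (suc (suc k)) ℤ.- + ψ a m (suc k)

-- ψ_min(m,t) = min_{a ∈ ℤ} ψ(a,m,t): the predicate "M is that minimum".
IsPsiMin : ℕ → ℕ → ℕ → Set
IsPsiMin m t M = Σ ℤ (λ a → ψ a m t ≡ M) × (∀ a → M ≤ ψ a m t)

r : ℕ → ℕ → ℕ
r m i = suc (_/_ (m ∸ 1) (p i) {{p-nonZero i}})

Σ[_⋯_] : ℕ → ℕ → (ℕ → ℤ) → ℤ
Σ[ k ⋯ n ] f = foldr (λ i acc → f i ℤ.+ acc) (+ 0) (range k n)

{-# OPTIONS --safe #-}
-- Fix i > t and d = p_i. Every q ≤ m counted by ν(a,m,i) is divisible by d and avoids
-- p_2, …, p_t, so a + q = (⌊a/d⌋ + j) d with 1 ≤ j ≤ r_{m,i}, and ⌊a/d⌋ + j avoids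
-- p_2, …, p_t as well. Since q is recovered from j, ν(a,m,i) is at most the number of
-- j ≤ r_{m,i} not counted by ψ(⌊a/d⌋, r_{m,i}, t), i.e. r_{m,i} - ψ(⌊a/d⌋, r_{m,i}, t),
-- which is at most r_{m,i} - ψ_min(r_{m,i}, t).
module Submission where

open import Defs
open import Data.Integer using (ℤ; +_; _-_) renaming (_≤_ to _≤ℤ_)

open import Level using (Level)
open import Data.Nat as ℕ using (ℕ; _≤_; _<_; zero; suc; z≤n; s≤s; NonZero; _∸_; _≟_)
open import Data.Nat.Properties
open import Data.Nat.DivMod using (_/_; m*n/n≡m; /-monoˡ-≤)
open import Data.Nat.Divisibility using (_∣_; _∣?_; ∣-refl; ∣-trans; ∣m⇒∣m*n)
open import Data.Integer as ℤ using (∣_∣)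
import Data.Integer.Properties as ℤ
open import Data.Integer.DivMod using (_/ℕ_; _%ℕ_; n%ℕd<d; a≡a%ℕn+[a/ℕn]*n)
import Data.Integer.Divisibility.Signed as ℤ
open import Data.Integer.Tactic.RingSolver using (solve-∀)
open import Data.Bool using (T; T?)
open import Data.List using (List; []; _∷_; length; filter; map; upTo; foldr)
open import Data.List.Properties using (filter-accept; filter-notAll; length-map; length-upTo)
open import Data.List.Relation.Unary.Any using (here; there)
open import Data.List.Relation.Unary.Any.Properties using (any⁺; any⁻)
open import Data.List.Relation.Unary.AllPairs using ([]; _∷_)
import Data.List.Relation.Unary.All as All
open import Data.List.Relation.Unary.Unique.Propositional using (Unique)
import Data.List.Relation.Unary.Unique.Propositional.Properties as Unique
open import Data.List.Relation.Binary.Subset.Propositional using (_⊆_)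
open import Data.List.Membership.Propositional using (_∈_; find; lose)
open import Data.List.Membership.Propositional.Properties
  using (∈-filter⁻; ∈-filter⁺; ∈-map⁻; ∈-map⁺; ∈-upTo⁻; ∈-upTo⁺)
open import Data.Sum using (_⊎_; inj₁; inj₂)
open import Data.Empty using (⊥-elim)
open import Data.Product using (_×_; _,_; proj₁; proj₂; ∃-syntax)
open import Function using (_∘_)
open import Relation.Nullary using (¬_; yes; no; ¬?; _×-dec_)
open import Relation.Nullary.Decidable using (toWitness; fromWitness)
open import Relation.Unary using (Pred; Decidable; ∁)
open import Relation.Unary.Properties using (∁?)
open import Relation.Binary using (DecidableEquality)
open import Relation.Binary.PropositionalEquality

private
  variable
    ℓ₁ ℓ₂ ℓ₃ : Level
    A : Set ℓ₁

module _ {P : Pred A ℓ₁} (P? : Decidable P) where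

  length-filter-∷ : ∀ x xs → length (filter P? xs) ≤ length (filter P? (x ∷ xs))
  length-filter-∷ x xs with P? x
  ... | yes _ = n≤1+n _
  ... | no _  = ≤-refl

  length-filter+length-filter-∁ : ∀ xs →
    length (filter P? xs) ℕ.+ length (filter (∁? P?) xs) ≡ length xs
  length-filter+length-filter-∁ []       = refl
  length-filter+length-filter-∁ (x ∷ xs) with P? x
  ... | yes _ = cong suc (length-filter+length-filter-∁ xs)
  ... | no _  = trans (+-suc _ _) (cong suc (length-filter+length-filter-∁ xs))

module _ {P : Pred A ℓ₁} {Q : Pred A ℓ₂} {R : Pred A ℓ₃}
         (P? : Decidable P) (Q? : Decidable Q) (R? : Decidable R)
         (P⊆Q∪R : ∀ {x} → P x → Q x ⊎ R x) where

  length-filter-≤-∪ : ∀ xs →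
    length (filter P? xs) ≤ length (filter Q? xs) ℕ.+ length (filter R? xs)
  length-filter-≤-∪ []       = z≤n
  length-filter-≤-∪ (x ∷ xs) with P? x | length-filter-≤-∪ xs
  ... | no _   | ih = ≤-trans ih (+-mono-≤ (length-filter-∷ Q? x xs) (length-filter-∷ R? x xs))
  ... | yes px | ih with P⊆Q∪R px
  ...   | inj₁ qx = ≤-trans (s≤s (≤-trans ih (+-monoʳ-≤ _ (length-filter-∷ R? x xs))))
                            (≤-reflexive (cong (λ ys → length ys ℕ.+ _) (sym (filter-accept Q? qx))))
  ...   | inj₂ rx = ≤-trans (s≤s ih)
                            (≤-trans (≤-reflexive (sym (+-suc _ _)))
                                     (+-mono-≤ (length-filter-∷ Q? x xs)
                                               (≤-reflexive (cong length (sym (filter-accept R? rx))))))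

module _ (_≟ᴬ_ : DecidableEquality A) where

  Unique-⊆⇒length≤ : {xs ys : List A} → Unique xs → xs ⊆ ys → length xs ≤ length ys
  Unique-⊆⇒length≤ {[]}     _             _     = z≤n
  Unique-⊆⇒length≤ {x ∷ xs} {ys} (x∉xs ∷ u) xs⊆ys =
    ≤-trans (s≤s (Unique-⊆⇒length≤ u xs⊆ys-x))
            (filter-notAll (λ y → ¬? (y ≟ᴬ x)) ys (lose (xs⊆ys (here refl)) (λ x≢x → x≢x refl)))
    where
    xs⊆ys-x : xs ⊆ filter (λ y → ¬? (y ≟ᴬ x)) ys
    xs⊆ys-x y∈xs = ∈-filter⁺ (λ y → ¬? (y ≟ᴬ x)) (xs⊆ys (there y∈xs))
                     (λ y≡x → All.lookup x∉xs y∈xs (sym y≡x))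

∈-range⁻ : ∀ {lo hi x} → x ∈ range lo hi → lo ≤ x × x ≤ hi
∈-range⁻ {lo} {hi} x∈ with ∈-map⁻ (lo ℕ.+_) x∈
... | y , y∈ , refl = m≤m+n lo y , subst (_≤ hi) (+-comm y lo) (≤-pred y+lo<1+hi)
  where
  y< : y < suc hi ∸ lo
  y< = ∈-upTo⁻ y∈
  lo<1+hi : lo < suc hi
  lo<1+hi = m∸n≢0⇒n<m (λ eq → n≮0 (subst (y <_) eq y<))
  y+lo<1+hi : y ℕ.+ lo < suc hi
  y+lo<1+hi = m≤o∸n⇒m+n≤o (suc y) (<⇒≤ lo<1+hi) y<

∈-range⁺ : ∀ {lo hi x} → lo ≤ x → x ≤ hi → x ∈ range lo hi
∈-range⁺ {lo} {hi} lo≤x x≤hi = subst (_∈ range lo hi) (m+[n∸m]≡n lo≤x)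
  (∈-map⁺ (lo ℕ.+_) (∈-upTo⁺ (∸-monoˡ-< (s≤s x≤hi) lo≤x)))

range-Unique : ∀ lo hi → Unique (range lo hi)
range-Unique lo hi = Unique.map⁺ (+-cancelˡ-≡ lo _ _)
  (Unique.applyUpTo⁺₁ (λ i → i) (suc hi ∸ lo) (λ i<j _ → <⇒≢ i<j))

length-range : ∀ lo hi → length (range lo hi) ≡ suc hi ∸ lo
length-range lo hi = trans (length-map (lo ℕ.+_) (upTo (suc hi ∸ lo))) (length-upTo _)

module _ (d : ℕ) .{{_ : NonZero d}} where

  quotient-window : ∀ {s q m} j → s < d → 1 ≤ q → q ≤ m → j ℕ.* d ≡ s ℕ.+ q →
    1 ≤ j × j ≤ suc ((m ∸ 1) / d)
  quotient-window {s} {suc q} zero    _   _ _   eq = ⊥-elim (m+1+n≢0 s (sym eq))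
  quotient-window {s} {suc q} {m} (suc j) s<d _ q<m eq = s≤s z≤n , s≤s j≤[m∸1]/d
    where
    open ≤-Reasoning
    j*d≤q : j ℕ.* d ≤ q
    j*d≤q = +-cancelˡ-≤ d _ _ (begin
      d ℕ.+ j ℕ.* d ≡⟨ eq ⟩
      s ℕ.+ suc q   ≡⟨ +-suc s q ⟩
      suc s ℕ.+ q   ≤⟨ +-monoˡ-≤ q s<d ⟩
      d ℕ.+ q       ∎)
    j≤[m∸1]/d : j ≤ (m ∸ 1) / d
    j≤[m∸1]/d = subst (_≤ (m ∸ 1) / d) (m*n/n≡m j d)
                  (/-monoˡ-≤ d (≤-trans j*d≤q (∸-monoˡ-≤ 1 q<m)))

  +-split-%ℕ : ∀ a q → a ℤ.+ + q ≡ + (a %ℕ d ℕ.+ q) ℤ.+ a /ℕ d ℤ.* + d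
  +-split-%ℕ a q = begin
    a ℤ.+ + q                               ≡⟨ cong (ℤ._+ + q) (a≡a%ℕn+[a/ℕn]*n a d) ⟩
    (+ (a %ℕ d) ℤ.+ a /ℕ d ℤ.* + d) ℤ.+ + q ≡⟨ regroup (+ (a %ℕ d)) (a /ℕ d ℤ.* + d) (+ q) ⟩
    (+ (a %ℕ d) ℤ.+ + q) ℤ.+ a /ℕ d ℤ.* + d ≡⟨ cong (ℤ._+ a /ℕ d ℤ.* + d) (sym (ℤ.pos-+ (a %ℕ d) q)) ⟩
    + (a %ℕ d ℕ.+ q) ℤ.+ a /ℕ d ℤ.* + d     ∎
    where
    open ≡-Reasoning
    regroup : ∀ (x y z : ℤ) → (x ℤ.+ y) ℤ.+ z ≡ (x ℤ.+ z) ℤ.+ y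
    regroup = solve-∀

  ∣⇒quotient-offset : ∀ a q → d ∣ ∣ a ℤ.+ + q ∣ →
    ∃[ j ] (j ℕ.* d ≡ a %ℕ d ℕ.+ q × (a /ℕ d ℤ.+ + j) ℤ.* + d ≡ a ℤ.+ + q)
  ∣⇒quotient-offset a q d∣a+q = j , sym s+q≡j*d , [a/d+j]*d≡a+q
    where
    d∣s+q : d ∣ a %ℕ d ℕ.+ q
    d∣s+q = ℤ.∣⇒∣ᵤ {+ d} (ℤ.∣m+n∣n⇒∣m {m = + (a %ℕ d ℕ.+ q)}
              (ℤ.∣ᵤ⇒∣ (subst (λ x → d ∣ ∣ x ∣) (+-split-%ℕ a q) d∣a+q))
              (ℤ.∣n⇒∣m*n (a /ℕ d) (ℤ.∣-refl {+ d})))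
    open _∣_ d∣s+q renaming (quotient to j; equality to s+q≡j*d)

    [a/d+j]*d≡a+q : (a /ℕ d ℤ.+ + j) ℤ.* + d ≡ a ℤ.+ + q
    [a/d+j]*d≡a+q = begin
      (a /ℕ d ℤ.+ + j) ℤ.* + d            ≡⟨ distrib (a /ℕ d) (+ j) (+ d) ⟩
      + j ℤ.* + d ℤ.+ a /ℕ d ℤ.* + d      ≡⟨ cong (ℤ._+ a /ℕ d ℤ.* + d) (sym (ℤ.pos-* j d)) ⟩
      + (j ℕ.* d) ℤ.+ a /ℕ d ℤ.* + d      ≡⟨ cong (λ x → + x ℤ.+ a /ℕ d ℤ.* + d) (sym s+q≡j*d) ⟩
      + (a %ℕ d ℕ.+ q) ℤ.+ a /ℕ d ℤ.* + d ≡⟨ sym (+-split-%ℕ a q) ⟩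
      a ℤ.+ + q                           ∎
      where
      open ≡-Reasoning
      distrib : ∀ (x y z : ℤ) → (x ℤ.+ y) ℤ.* z ≡ y ℤ.* z ℤ.+ x ℤ.* z
      distrib = solve-∀

  ∣⇒quotient-window : ∀ a {q m} → 1 ≤ q → q ≤ m → d ∣ ∣ a ℤ.+ + q ∣ →
    ∃[ j ] ((1 ≤ j × j ≤ suc ((m ∸ 1) / d)) × (a /ℕ d ℤ.+ + j) ℤ.* + d ≡ a ℤ.+ + q)
  ∣⇒quotient-window a 1≤q q≤m d∣a+q =
    let j , j*d≡s+q , eq = ∣⇒quotient-offset a _ d∣a+q
    in  j , quotient-window j (n%ℕd<d a d) 1≤q q≤m j*d≡s+q , eq

hit⁻ : ∀ {a k q} → T (hit a k q) → ∃[ l ] (2 ≤ l × l ≤ k × p l ∣ ∣ a ℤ.+ + q ∣)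
hit⁻ {a} {k} {q} h =
  let l , l∈ , pl∣ = find (any⁻ _ (range 2 k) h)
      2≤l , l≤k = ∈-range⁻ {2} {k} l∈
  in  l , 2≤l , l≤k , toWitness pl∣

hit⁺ : ∀ {a k q l} → 2 ≤ l → l ≤ k → p l ∣ ∣ a ℤ.+ + q ∣ → T (hit a k q)
hit⁺ 2≤l l≤k pl∣ = any⁺ _ (lose (∈-range⁺ 2≤l l≤k) (fromWitness pl∣))

hit-mono : ∀ {a k k′ q} → k ≤ k′ → T (hit a k q) → T (hit a k′ q)
hit-mono {a} {k} {k′} {q} k≤k′ h with hit⁻ {a} {k} {q} h
... | l , 2≤l , l≤k , pl∣ = hit⁺ {a} {k′} {q} 2≤l (≤-trans l≤k k≤k′) pl∣

hit-∣ : ∀ {a b k q j} → ∣ b ℤ.+ + j ∣ ∣ ∣ a ℤ.+ + q ∣ → T (hit b k j) → T (hit a k q)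
hit-∣ {a} {b} {k} {q} {j} b+j∣a+q h with hit⁻ {b} {k} {j} h
... | l , 2≤l , l≤k , pl∣ = hit⁺ {a} {k} {q} 2≤l l≤k (∣-trans pl∣ b+j∣a+q)

NewMultiple : ℤ → ℕ → ℕ → ℕ → Set
NewMultiple a i t q = p i ∣ ∣ a ℤ.+ + q ∣ × ¬ T (hit a t q)

newMultiple? : ∀ a i t → Decidable (NewMultiple a i t)
newMultiple? a i t q = (p i ∣? ∣ a ℤ.+ + q ∣) ×-dec ¬? (T? (hit a t q))

hit-suc : ∀ {a t i q} → t ≤ i → T (hit a (suc i) q) → T (hit a i q) ⊎ NewMultiple a (suc i) t q
hit-suc {a} {t} {i} {q} t≤i h with hit⁻ {a} {suc i} {q} h
... | l , 2≤l , l≤1+i , pl∣ with m≤n⇒m<n∨m≡n l≤1+i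
...   | inj₁ l<1+i = inj₁ (hit⁺ {a} {i} {q} 2≤l (≤-pred l<1+i) pl∣)
...   | inj₂ refl with T? (hit a t q)
...     | yes ht = inj₁ (hit-mono {a} {t} {i} {q} t≤i ht)
...     | no ¬ht = inj₂ (pl∣ , ¬ht)

_/p_ : ℤ → ℕ → ℤ
a /p i = _/ℕ_ a (p i) {{p-nonZero i}}

-- q ↦ j with a + q = (⌊a / p_i⌋ + j) p_i; q is recovered from j, so we count through the inverse.
length-newMultiple≤ : ∀ a m i t →
  length (filter (newMultiple? a i t) (range 1 m))
    ≤ length (filter (∁? (T? ∘ hit (a /p i) t)) (range 1 (r m i)))
length-newMultiple≤ a m i t =
  ≤-trans (Unique-⊆⇒length≤ _≟_ (Unique.filter⁺ (newMultiple? a i t) (range-Unique 1 m)) ⊆-image)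
          (≤-reflexive (length-map offset (filter (∁? (T? ∘ hit (a /p i) t)) (range 1 (r m i)))))
  where
  instance
    p-nonZero-i : NonZero (p i)
    p-nonZero-i = p-nonZero i

  offset : ℕ → ℕ
  offset j = ∣ (a /p i ℤ.+ + j) ℤ.* + p i ℤ.- a ∣

  module _ {j q} (eq : (a /p i ℤ.+ + j) ℤ.* + p i ≡ a ℤ.+ + q) where

    offset-inverse : offset j ≡ q
    offset-inverse = cong ∣_∣ (trans (cong (ℤ._- a) eq) (cancel a (+ q)))
      where
      cancel : ∀ (x y : ℤ) → (x ℤ.+ y) ℤ.- x ≡ y
      cancel = solve-∀

    quotient∣a+q : ∣ a /p i ℤ.+ + j ∣ ∣ ∣ a ℤ.+ + q ∣
    quotient∣a+q = subst (∣ a /p i ℤ.+ + j ∣ ∣_)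
      (trans (sym (ℤ.abs-* (a /p i ℤ.+ + j) (+ p i))) (cong ∣_∣ eq)) (∣m⇒∣m*n (p i) ∣-refl)

  ⊆-image : filter (newMultiple? a i t) (range 1 m)
              ⊆ map offset (filter (∁? (T? ∘ hit (a /p i) t)) (range 1 (r m i)))
  ⊆-image {q} q∈ =
    let q∈range , pi∣a+q , ¬hit = ∈-filter⁻ (newMultiple? a i t) q∈
        1≤q , q≤m = ∈-range⁻ {1} {m} q∈range
        j , (1≤j , j≤r) , eq = ∣⇒quotient-window (p i) a 1≤q q≤m pi∣a+q
    in  subst (_∈ map offset _) (offset-inverse eq)
          (∈-map⁺ offset (∈-filter⁺ (∁? (T? ∘ hit (a /p i) t)) (∈-range⁺ 1≤j j≤r)
                                    (¬hit ∘ hit-∣ {a} {a /p i} {t} {q} {j} (quotient∣a+q eq))))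

ψ-suc+ψ≤ψ+r : ∀ a m {i t} → t ≤ i →
  ψ a m (suc i) ℕ.+ ψ (a /p suc i) (r m (suc i)) t ≤ ψ a m i ℕ.+ r m (suc i)
ψ-suc+ψ≤ψ+r a m {i} {t} t≤i = begin
  ψ a m (suc i) ℕ.+ ψ′           ≤⟨ +-monoˡ-≤ ψ′ hits≤old+new ⟩
  (ψ a m i ℕ.+ #new) ℕ.+ ψ′       ≤⟨ +-monoˡ-≤ ψ′ (+-monoʳ-≤ (ψ a m i) (length-newMultiple≤ a m (suc i) t)) ⟩
  (ψ a m i ℕ.+ #unhit) ℕ.+ ψ′     ≡⟨ +-assoc (ψ a m i) #unhit ψ′ ⟩
  ψ a m i ℕ.+ (#unhit ℕ.+ ψ′)     ≡⟨ cong (ψ a m i ℕ.+_) (+-comm #unhit ψ′) ⟩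
  ψ a m i ℕ.+ (ψ′ ℕ.+ #unhit)     ≡⟨ cong (ψ a m i ℕ.+_) (length-filter+length-filter-∁ (T? ∘ hit (a /p suc i) t) (range 1 R)) ⟩
  ψ a m i ℕ.+ length (range 1 R)  ≡⟨ cong (ψ a m i ℕ.+_) (length-range 1 R) ⟩
  ψ a m i ℕ.+ R                   ∎
  where
  open ≤-Reasoning
  R ψ′ #new #unhit : ℕ
  R = r m (suc i)
  ψ′ = ψ (a /p suc i) R t
  #new = length (filter (newMultiple? a (suc i) t) (range 1 m))
  #unhit = length (filter (∁? (T? ∘ hit (a /p suc i) t)) (range 1 R))
  hits≤old+new : ψ a m (suc i) ≤ ψ a m i ℕ.+ #new
  hits≤old+new = length-filter-≤-∪ (T? ∘ hit a (suc i)) (T? ∘ hit a i) (newMultiple? a (suc i) t)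
                   (hit-suc {a} t≤i) (range 1 m)

m+q≤n+o⇒m-n≤o-q : ∀ {m n o q} → m ℕ.+ q ≤ n ℕ.+ o → + m - + n ≤ℤ + o - + q
m+q≤n+o⇒m-n≤o-q {m} {n} {o} {q} m+q≤n+o = begin
  + m - + n                       ≡⟨ shift (+ m) (+ n) (+ q) ⟩
  (+ m ℤ.+ + q) - (+ n ℤ.+ + q)   ≤⟨ ℤ.+-monoˡ-≤ (ℤ.- (+ n ℤ.+ + q)) m+q≤ℤn+o ⟩
  (+ n ℤ.+ + o) - (+ n ℤ.+ + q)   ≡⟨ cancel (+ n) (+ o) (+ q) ⟩
  + o - + q                       ∎
  where
  open ℤ.≤-Reasoning
  shift : ∀ (x y z : ℤ) → x - y ≡ (x ℤ.+ z) - (y ℤ.+ z)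
  shift = solve-∀
  cancel : ∀ (x y z : ℤ) → (x ℤ.+ y) - (x ℤ.+ z) ≡ y - z
  cancel = solve-∀
  m+q≤ℤn+o : + m ℤ.+ + q ≤ℤ + n ℤ.+ + o
  m+q≤ℤn+o = subst₂ _≤ℤ_ (ℤ.pos-+ m q) (ℤ.pos-+ n o) (ℤ.+≤+ m+q≤n+o)

ν≤r-ψ : ∀ a m {i t} → 2 ≤ i → t < i → ν a m i ≤ℤ + r m i - + ψ (a /p i) (r m i) t
ν≤r-ψ a m {suc zero}    (s≤s ()) _
ν≤r-ψ a m {suc (suc i)} {t} _ (s≤s t≤1+i) =
  m+q≤n+o⇒m-n≤o-q {ψ a m (suc (suc i))} {ψ a m (suc i)} {r m (suc (suc i))}
                  {ψ (a /p suc (suc i)) (r m (suc (suc i))) t}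
                  (ψ-suc+ψ≤ψ+r a m t≤1+i)

∑ : List ℕ → (ℕ → ℤ) → ℤ
∑ xs f = foldr (λ i acc → f i ℤ.+ acc) (+ 0) xs

∑-mono-≤ : ∀ xs {f g} → (∀ {i} → i ∈ xs → f i ≤ℤ g i) → ∑ xs f ≤ℤ ∑ xs g
∑-mono-≤ []       _   = ℤ.≤-refl
∑-mono-≤ (x ∷ xs) f≤g = ℤ.+-mono-≤ (f≤g (here refl)) (∑-mono-≤ xs (f≤g ∘ there))

∑-distrib-minus : ∀ xs f g → ∑ xs (λ i → f i - g i) ≡ ∑ xs f - ∑ xs g
∑-distrib-minus []       f g = refl
∑-distrib-minus (x ∷ xs) f g = trans (cong (ℤ._+_ (f x - g x)) (∑-distrib-minus xs f g))
                                     (interchange (f x) (g x) (∑ xs f) (∑ xs g))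
  where
  interchange : ∀ (u v U V : ℤ) → (u - v) ℤ.+ (U - V) ≡ (u ℤ.+ U) - (v ℤ.+ V)
  interchange = solve-∀

corollary2p7 : (a : ℤ) (m n t k : ℕ) → 1 ≤ m → 1 ≤ n → 2 ≤ k → 1 ≤ t → t < k →
    (ψmin : ℕ → ℕ) → (∀ i → IsPsiMin (r m i) t (ψmin (r m i))) →
    Σ[ k ⋯ n ] (λ i → ν a m i)
      ≤ℤ (Σ[ k ⋯ n ] (λ i → + r m i) - Σ[ k ⋯ n ] (λ i → + ψmin (r m i)))
corollary2p7 a m n t k _ _ 2≤k _ t<k ψmin ψmin-isMin = begin
  ∑ (range k n) (ν a m)                                ≤⟨ ∑-mono-≤ (range k n) ν≤r-ψmin ⟩
  ∑ (range k n) (λ i → + r m i - + ψmin (r m i))       ≡⟨ ∑-distrib-minus (range k n) (λ i → + r m i) (λ i → + ψmin (r m i)) ⟩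
  ∑ (range k n) (λ i → + r m i) - ∑ (range k n) (λ i → + ψmin (r m i)) ∎
  where
  open ℤ.≤-Reasoning
  ν≤r-ψmin : ∀ {i} → i ∈ range k n → ν a m i ≤ℤ + r m i - + ψmin (r m i)
  ν≤r-ψmin {i} i∈ = ℤ.≤-trans (ν≤r-ψ a m (≤-trans 2≤k k≤i) (<-≤-trans t<k k≤i))
    (ℤ.+-monoʳ-≤ (+ r m i) (ℤ.neg-mono-≤ (ℤ.+≤+ (proj₂ (ψmin-isMin i) (a /p i)))))
    where
    k≤i : k ≤ i
    k≤i = proj₁ (∈-range⁻ i∈)
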